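{- Let $q$ be a prime power, $n\ge2$, $m\ge1$, $V=(\mathbb F_q)^n$ with basis $v_1,\dots,v_n$ such that $v_1,\dots,v_{n-1}$ span a hyperplane $H$, dual basis $x_1,\dots,x_n$, $S=\mathbb F_q[x_1,\dots,x_n]$, $G=\mathrm{GL}_n(\mathbb F_q)_H$, $\tilde f_i=x_i^q-x_ix_n^{q-1}$ ($i<n$), and $$B_G=\mathbb F_q[\tilde f_1,\dots,\tilde f_{n-1}]\text{ -span}\Big\{x_1^{a_1}\cdots x_{n-1}^{a_{n-1}}x_n^{q^m-1}+\mathfrak m^{[q^m]}:0\le a_i<q,\ \textstyle\sum a_i\ge2\Big\}\subseteq S/\mathfrak m^{[q^m]}.$$ Then $$\mathrm{Hilb}(B_G,t)=t^{q^m-1}\Big(\Big(\frac{1-t^q}{1-t}\Big)^{n-1}-(n-1)t-1\Big)\Big(\frac{1-t^{q^m}}{1-t^q}\Big)^{n-1}.$$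
   Context: $\mathfrak m^{[q^m]}=(x_1^{q^m},\dots,x_n^{q^m})$; $S/\mathfrak m^{[q^m]}$ is graded by degree; $\mathrm{Hilb}(M,t)=\sum_d\dim M_dt^d$. -}

module Defs where

open import Level using (Level; _⊔_)
open import Algebra.Bundles using (CommutativeRing)
open import Data.Bool using (Bool; true; false; if_then_else_; _∧_)
open import Data.Nat as ℕ using (ℕ; zero; suc; _<_; _≤_; _∸_; _^_; _≡ᵇ_)
open import Data.Fin using (Fin; fromℕ; inject₁; toℕ)
import Data.Fin.Properties as FinP
open import Data.Nat.ListAction using () renaming (sum to sumℕ)
open import Data.List as L using (List; []; _∷_; _++_; map; concatMap; foldr; allFin; replicate)
open import Data.Product using (Σ; _×_; _,_; proj₁; proj₂)
open import Data.Integer as ℤ using (ℤ)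
open import Relation.Nullary using (¬_; does)
open import Relation.Binary.PropositionalEquality using (_≡_)

private
  variable
    c ℓ : Level

IsField : CommutativeRing c ℓ → Set (c ⊔ ℓ)
IsField R = ¬ (1# ≈ 0#) × (∀ x → ¬ (x ≈ 0#) → Σ Carrier λ y → (x * y) ≈ 1#)
  where open CommutativeRing R

HasCardinality : CommutativeRing c ℓ → ℕ → Set (c ⊔ ℓ)
HasCardinality R q =
  Σ (Fin q → Carrier) λ e →
    (∀ x → Σ (Fin q) λ i → e i ≈ x) × (∀ i j → e i ≈ e j → i ≡ j)
  where open CommutativeRing R

-- Polynomials in N variables over R, as finite formal sums of terms
-- (coefficient, exponent vector).  Two formal sums represent the same
-- polynomial iff all their coefficients agree.

module Poly (R : CommutativeRing c ℓ) (N : ℕ) where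
  open CommutativeRing R

  Exp : Set
  Exp = Fin N → ℕ

  Pol : Set c
  Pol = List (Carrier × Exp)

  _=E_ : Exp → Exp → Bool
  e =E f = foldr (λ i b → (e i ≡ᵇ f i) ∧ b) true (allFin N)

  _+E_ : Exp → Exp → Exp
  (e +E f) i = e i ℕ.+ f i

  zeroE : Exp
  zeroE _ = 0

  unitE : Fin N → ℕ → Exp
  unitE j k i = if does (j FinP.≟ i) then k else 0

  degE : Exp → ℕ
  degE e = sumℕ (map e (allFin N))

  coeff : Pol → Exp → Carrier
  coeff p e = foldr (λ t acc → if proj₂ t =E e then proj₁ t + acc else acc) 0# p

  zeroP : Pol
  zeroP = []

  oneP : Pol
  oneP = (1# , zeroE) ∷ []

  _⊕_ : Pol → Pol → Pol
  _⊕_ = _++_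

  scale : Carrier → Pol → Pol
  scale a = map (λ t → (a * proj₁ t , proj₂ t))

  _⊗_ : Pol → Pol → Pol
  p ⊗ r = concatMap (λ t → map (λ u → (proj₁ t * proj₁ u , proj₂ t +E proj₂ u)) r) p

  powP : Pol → ℕ → Pol
  powP p zero    = oneP
  powP p (suc k) = p ⊗ powP p k

  sumFin : ∀ k → (Fin k → Pol) → Pol
  sumFin k f = concatMap f (allFin k)

  -- The quotient A = S / 𝔪^[Q], 𝔪^[Q] = (x_1^Q, …, x_N^Q).
  -- Its monomial basis is {x^e : all e_i < Q}; two polynomials are equal
  -- in A iff their coefficients agree on those exponents.

  module Quot (Q : ℕ) where

    InBox : Exp → Set
    InBox e = ∀ i → e i < Q

    _≈A_ : Pol → Pol → Set ℓ
    p ≈A r = ∀ e → InBox e → coeff p e ≈ coeff r e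

    HomogA : ℕ → Pol → Set ℓ
    HomogA d p = ∀ e → InBox e → ¬ (degE e ≡ d) → coeff p e ≈ 0#

    lincomb : ∀ {k} → (Fin k → Carrier) → (Fin k → Pol) → Pol
    lincomb {k} a w = sumFin k (λ i → scale (a i) (w i))

    LinIndep : ∀ {k} → (Fin k → Pol) → Set (c ⊔ ℓ)
    LinIndep {k} w = ∀ (a : Fin k → Carrier) → lincomb a w ≈A zeroP → ∀ i → a i ≈ 0#

    HasDim : ∀ {ℓ'} → (Pol → Set ℓ') → ℕ → Set (c ⊔ ℓ ⊔ ℓ')
    HasDim W k =
      Σ (Fin k → Pol) λ w →
        (∀ i → W (w i)) × LinIndep w ×
        (∀ p → W p → Σ (Fin k → Carrier) λ a → p ≈A lincomb a w)

-- The setup of the lemma, with n = suc r variables x_1 … x_n: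
-- x_i (i < n) is  inject₁ i  for i : Fin r,  x_n is  fromℕ r.

module Setup (R : CommutativeRing c ℓ) (q r m : ℕ) where
  open CommutativeRing R
  open Poly R (suc r) public

  Q : ℕ
  Q = q ^ m

  open Quot Q public

  xlast : Fin (suc r)
  xlast = fromℕ r

  ftilde : Fin r → Pol
  ftilde i = (1# , unitE (inject₁ i) q)
           ∷ (- 1# , unitE (inject₁ i) 1 +E unitE xlast (q ∸ 1))
           ∷ []

  -- elements of 𝔽_q[f̃_1,…,f̃_{n−1}] given by polynomials P in n−1
  -- variables (formal sums of terms (c, b)), evaluated at the f̃_i
  FPol : Set c
  FPol = List (Carrier × (Fin r → ℕ))

  evalF : FPol → Pol
  evalF = concatMap (λ t → scale (proj₁ t)
            (foldr (λ i acc → powP (ftilde i) (proj₂ t i) ⊗ acc) oneP (allFin r)))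

  Admissible : (Fin r → ℕ) → Set
  Admissible a = (∀ i → a i < q) × (2 ≤ sumℕ (map a (allFin r)))

  gen : (Fin r → ℕ) → Pol
  gen a = (1# , foldr (λ i e → unitE (inject₁ i) (a i) +E e)
                       (unitE xlast (Q ∸ 1)) (allFin r)) ∷ []

  -- an element of B_G: Σ_a P_a(f̃) · gen a  (finitely many admissible a)
  BGRep : Set c
  BGRep = List (Σ (Fin r → ℕ) λ a → Admissible a × FPol)

  valueRep : BGRep → Pol
  valueRep = concatMap (λ t → evalF (proj₂ (proj₂ t)) ⊗ gen (proj₁ t))

  InBG : Pol → Set (c ⊔ ℓ)
  InBG p = Σ BGRep λ ρ → p ≈A valueRep ρ

  BGd : ℕ → Pol → Set (c ⊔ ℓ)
  BGd d p = InBG p × HomogA d p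

-- Integer polynomials in t as coefficient lists (index = degree).

IPoly : Set
IPoly = List ℤ

addI : IPoly → IPoly → IPoly
addI []       ys       = ys
addI xs       []       = xs
addI (x ∷ xs) (y ∷ ys) = (x ℤ.+ y) ∷ addI xs ys

negI : IPoly → IPoly
negI = map (λ x → ℤ.- x)

mulI : IPoly → IPoly → IPoly
mulI []       ys = []
mulI (x ∷ xs) ys = addI (map (x ℤ.*_) ys) (0ℤ ∷ mulI xs ys)
  where 0ℤ = ℤ.+ 0

constI : ℤ → IPoly
constI a = a ∷ []

monoI : ℕ → IPoly
monoI k = replicate k (ℤ.+ 0) L.++ (ℤ.+ 1 ∷ [])

powI : IPoly → ℕ → IPoly
powI p zero    = constI (ℤ.+ 1)
powI p (suc k) = mulI p (powI p k)

coeffI : IPoly → ℕ → ℤ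
coeffI []       _       = ℤ.+ 0
coeffI (x ∷ xs) zero    = x
coeffI (x ∷ xs) (suc d) = coeffI xs d

-- Σ_{j < count} t^{step·j};  geomI 1 q = (1−t^q)/(1−t),
-- geomI q (q^(m−1)) = (1−t^(q^m))/(1−t^q)  (exact polynomial quotients)
geomI : ℕ → ℕ → IPoly
geomI step zero        = []
geomI step (suc count) = addI (geomI step count) (monoI (step ℕ.* count))

hilbRHS : (q m n : ℕ) → IPoly
hilbRHS q m n =
  mulI (monoI (q ^ m ∸ 1))
    (mulI (addI (powI (geomI 1 q) (n ∸ 1))
                (negI (addI (mulI (constI (ℤ.+ (n ∸ 1))) (monoI 1)) (constI (ℤ.+ 1)))))
          (powI (geomI q (q ^ (m ∸ 1))) (n ∸ 1)))

-- Write Q = q^m and gen a = x^a xₙ^(Q−1). Every term of f̃^b = ∏ f̃ᵢ^bᵢ is either divisible by xₙ,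
-- and then dies modulo 𝔪^[Q] once multiplied by xₙ^(Q−1), or a multiple of x^(q b); the
-- coefficients of the latter add up to f̃^b(1, …, 1, 0) = 1. Hence f̃^b · gen a ≡ x^(a+qb) xₙ^(Q−1),
-- so B_G is spanned by the distinct monomials x^(a+qb) xₙ^(Q−1) with a admissible and bᵢ < q^(m−1)
-- (exactly those that survive in S/𝔪^[Q]); being distinct monomials they are independent.
-- Counting them by degree, the a's contribute ((1−t^q)/(1−t))^(n−1) minus its terms 1 + (n−1)t of
-- degree below 2, the b's contribute ((1−t^(q^m))/(1−t^q))^(n−1), and xₙ^(Q−1) contributes t^(Q−1).

module Submission where

open import Defs
open import Algebra.Bundles using (CommutativeRing; CommutativeMonoid)
import Algebra.Properties.Semiring.Sum as SemiringSum
import Relation.Binary.Reasoning.Setoid as SetoidReasoning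
open import Data.Bool using (Bool; true; false; T; _∧_)
import Data.Bool.Properties as BoolP
open import Data.Fin as Fin using (Fin; inject₁; fromℕ; punchIn)
import Data.Fin.Properties as FinP
open import Data.Integer as ℤ using (ℤ; +_)
import Data.Integer.Properties as ℤP
open import Data.Integer.Tactic.RingSolver using (solve-∀)
open import Data.List as L
  using (List; []; _∷_; _++_; map; filter; cartesianProductWith; cartesianProduct; downFrom; length)
import Data.List.Properties as LP
open import Data.List.Membership.Propositional using (_∈_)
import Data.List.Membership.Propositional.Properties as ∈P
open import Data.List.Relation.Unary.All as All using (All; []; _∷_)
import Data.List.Relation.Unary.All.Properties as AllP
open import Data.List.Relation.Unary.AllPairs using ([]; _∷_)
open import Data.List.Relation.Unary.Any as Any using (here)
import Data.List.Relation.Unary.Any.Properties as AnyP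
open import Data.List.Relation.Unary.Unique.Propositional using (Unique)
import Data.List.Relation.Unary.Unique.Propositional.Properties as UniqueP
open import Data.Nat as ℕ using (ℕ; zero; suc; NonZero; _≤_; _<_; _∸_; _^_; _≟_; _≤?_; z≤n; s≤s)
open import Data.Nat.DivMod using (_%_; [m+kn]%n≡m%n; m<n⇒m%n≡m)
open import Data.Nat.ListAction using () renaming (sum to sumℕ)
import Data.Nat.Properties as ℕP
open import Data.Product using (Σ; _×_; _,_; proj₁; proj₂; uncurry)
open import Data.Sum using (_⊎_; inj₁; inj₂)
open import Data.Vec as V using (Vec)
import Data.Vec.Properties as VP
open import Data.Vec.Functional using (Vector)
open import Function using (_∘_)
open import Function.Bundles using (Equivalence)
open import Relation.Binary.PropositionalEquality
  using (_≡_; _≢_; _≗_; refl; sym; trans; cong; cong₂; subst; module ≡-Reasoning)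
open import Relation.Nullary using (Dec; yes; no; ¬_; contradiction)
open import Relation.Nullary.Decidable using (dec-true; dec-false)

module ℕΣ = SemiringSum ℕP.+-*-semiring
open ℕΣ using () renaming (sum to ∑)

-- Coefficient sequences of integer polynomials

Series : Set
Series = ℕ → ℤ

δ : ℕ → Series
δ zero    zero    = + 1
δ zero    (suc _) = + 0
δ (suc k) zero    = + 0
δ (suc k) (suc d) = δ k d

infixl 7 _⋆_

_⋆_ : Series → Series → Series
(f ⋆ g) zero    = f 0 ℤ.* g 0
(f ⋆ g) (suc d) = f 0 ℤ.* g (suc d) ℤ.+ ((f ∘ suc) ⋆ g) d

shift : ℕ → Series → Series
shift zero    g d       = g d
shift (suc k) g zero    = + 0
shift (suc k) g (suc d) = shift k g d

δ-refl : ∀ k → δ k k ≡ + 1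
δ-refl zero    = refl
δ-refl (suc k) = δ-refl k

δ-≢ : ∀ {k d} → k ≢ d → δ k d ≡ + 0
δ-≢ {zero}  {zero}  k≢d = contradiction refl k≢d
δ-≢ {zero}  {suc d} _   = refl
δ-≢ {suc k} {zero}  _   = refl
δ-≢ {suc k} {suc d} k≢d = δ-≢ (k≢d ∘ cong suc)

δ-+ : ∀ k j → δ (k ℕ.+ j) ≗ shift k (δ j)
δ-+ zero    j d       = refl
δ-+ (suc k) j zero    = refl
δ-+ (suc k) j (suc d) = δ-+ k j d

shift-zero : ∀ k → shift k (λ _ → + 0) ≗ λ _ → + 0
shift-zero zero    d       = refl
shift-zero (suc k) zero    = refl
shift-zero (suc k) (suc d) = shift-zero k d

shift-+ : ∀ k f g d → shift k (λ n → f n ℤ.+ g n) d ≡ shift k f d ℤ.+ shift k g d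
shift-+ zero    f g d       = refl
shift-+ (suc k) f g zero    = refl
shift-+ (suc k) f g (suc d) = shift-+ k f g d

shift-cong : ∀ k {f g} → f ≗ g → shift k f ≗ shift k g
shift-cong zero    f≗g d       = f≗g d
shift-cong (suc k) f≗g zero    = refl
shift-cong (suc k) f≗g (suc d) = shift-cong k f≗g d

⋆-cong : ∀ {f f′ g g′} → f ≗ f′ → g ≗ g′ → f ⋆ g ≗ f′ ⋆ g′
⋆-cong f≗ g≗ zero    = cong₂ ℤ._*_ (f≗ 0) (g≗ 0)
⋆-cong f≗ g≗ (suc d) = cong₂ ℤ._+_ (cong₂ ℤ._*_ (f≗ 0) (g≗ (suc d))) (⋆-cong (f≗ ∘ suc) g≗ d)

⋆-zeroˡ : ∀ {f} g → f ≗ (λ _ → + 0) → f ⋆ g ≗ λ _ → + 0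
⋆-zeroˡ g f≗0 zero    rewrite f≗0 0 = refl
⋆-zeroˡ g f≗0 (suc d) rewrite f≗0 0 = trans (ℤP.+-identityˡ _) (⋆-zeroˡ g (f≗0 ∘ suc) d)

⋆-distribʳ-+ : ∀ f f′ g d → ((λ n → f n ℤ.+ f′ n) ⋆ g) d ≡ (f ⋆ g) d ℤ.+ (f′ ⋆ g) d
⋆-distribʳ-+ f f′ g zero    = ℤP.*-distribʳ-+ (g 0) (f 0) (f′ 0)
⋆-distribʳ-+ f f′ g (suc d) rewrite ⋆-distribʳ-+ (f ∘ suc) (f′ ∘ suc) g d =
  regroup (f 0) (f′ 0) (g (suc d)) ((f ∘ suc ⋆ g) d) ((f′ ∘ suc ⋆ g) d)
  where
  regroup : ∀ a b c x y → (a ℤ.+ b) ℤ.* c ℤ.+ (x ℤ.+ y) ≡ (a ℤ.* c ℤ.+ x) ℤ.+ (b ℤ.* c ℤ.+ y)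
  regroup = solve-∀

δ-⋆ : ∀ k g → δ k ⋆ g ≗ shift k g
δ-⋆ zero    g zero    = ℤP.*-identityˡ (g 0)
δ-⋆ zero    g (suc d) = begin
  + 1 ℤ.* g (suc d) ℤ.+ (δ 0 ∘ suc ⋆ g) d
    ≡⟨ cong₂ ℤ._+_ (ℤP.*-identityˡ (g (suc d))) (⋆-zeroˡ g (λ _ → refl) d) ⟩
  g (suc d) ℤ.+ + 0
    ≡⟨ ℤP.+-identityʳ _ ⟩
  g (suc d)
    ∎
  where open ≡-Reasoning
δ-⋆ (suc k) g zero    = refl
δ-⋆ (suc k) g (suc d) = trans (ℤP.+-identityˡ _) (δ-⋆ k g d)

coeffI-addI : ∀ p s d → coeffI (addI p s) d ≡ coeffI p d ℤ.+ coeffI s d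
coeffI-addI []      s       d       = sym (ℤP.+-identityˡ _)
coeffI-addI (x ∷ p) []      d       = sym (ℤP.+-identityʳ _)
coeffI-addI (x ∷ p) (y ∷ s) zero    = refl
coeffI-addI (x ∷ p) (y ∷ s) (suc d) = coeffI-addI p s d

coeffI-negI : ∀ p d → coeffI (negI p) d ≡ ℤ.- coeffI p d
coeffI-negI []      d       = refl
coeffI-negI (x ∷ p) zero    = refl
coeffI-negI (x ∷ p) (suc d) = coeffI-negI p d

coeffI-monoI : ∀ k → coeffI (monoI k) ≗ δ k
coeffI-monoI zero    zero    = refl
coeffI-monoI zero    (suc d) = refl
coeffI-monoI (suc k) zero    = refl
coeffI-monoI (suc k) (suc d) = coeffI-monoI k d

coeffI-map-* : ∀ x s → coeffI (map (x ℤ.*_) s) ≗ λ d → x ℤ.* coeffI s d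
coeffI-map-* x []      d       = sym (ℤP.*-zeroʳ x)
coeffI-map-* x (y ∷ s) zero    = refl
coeffI-map-* x (y ∷ s) (suc d) = coeffI-map-* x s d

coeffI-mulI : ∀ p s → coeffI (mulI p s) ≗ coeffI p ⋆ coeffI s
coeffI-mulI []      s d       = sym (⋆-zeroˡ (coeffI s) (λ _ → refl) d)
coeffI-mulI (x ∷ p) s zero    =
  trans (coeffI-addI (map (x ℤ.*_) s) _ 0) (trans (ℤP.+-identityʳ _) (coeffI-map-* x s 0))
coeffI-mulI (x ∷ p) s (suc d) =
  trans (coeffI-addI (map (x ℤ.*_) s) _ (suc d))
        (cong₂ ℤ._+_ (coeffI-map-* x s (suc d)) (coeffI-mulI p s d))

-- Generating functions of weighted lists

private
  variable
    A B C : Set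

count : (A → ℕ) → List A → Series
count w []       d = + 0
count w (x ∷ xs) d = δ (w x) d ℤ.+ count w xs d

count-++ : ∀ (w : A → ℕ) xs ys d → count w (xs ++ ys) d ≡ count w xs d ℤ.+ count w ys d
count-++ w []       ys d = sym (ℤP.+-identityˡ _)
count-++ w (x ∷ xs) ys d rewrite count-++ w xs ys d = sym (ℤP.+-assoc (δ (w x) d) _ _)

count-cong : ∀ {w w′ : A → ℕ} → w ≗ w′ → ∀ xs → count w xs ≗ count w′ xs
count-cong w≗w′ []       d = refl
count-cong w≗w′ (x ∷ xs) d = cong₂ ℤ._+_ (cong (λ k → δ k d) (w≗w′ x)) (count-cong w≗w′ xs d)

count-map : ∀ (w : B → ℕ) (f : A → B) xs → count w (map f xs) ≗ count (w ∘ f) xs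
count-map w f []       d = refl
count-map w f (x ∷ xs) d = cong₂ ℤ._+_ (refl {x = δ (w (f x)) d}) (count-map w f xs d)

count-shift : ∀ (w : A → ℕ) k xs → count (λ x → k ℕ.+ w x) xs ≗ shift k (count w xs)
count-shift w k []       d = sym (shift-zero k d)
count-shift w k (x ∷ xs) d = begin
  δ (k ℕ.+ w x) d ℤ.+ count (λ x → k ℕ.+ w x) xs d
    ≡⟨ cong₂ ℤ._+_ (δ-+ k (w x) d) (count-shift w k xs d) ⟩
  shift k (δ (w x)) d ℤ.+ shift k (count w xs) d
    ≡⟨ shift-+ k (δ (w x)) (count w xs) d ⟨
  shift k (count w (x ∷ xs)) d
    ∎
  where open ≡-Reasoning

count-cartesianProductWith :
  ∀ (f : A → B → C) (w : C → ℕ) (u : A → ℕ) (v : B → ℕ) →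
  (∀ x y → w (f x y) ≡ u x ℕ.+ v y) →
  ∀ xs ys → count w (cartesianProductWith f xs ys) ≗ count u xs ⋆ count v ys
count-cartesianProductWith f w u v w≡u+v []       ys d = sym (⋆-zeroˡ (count v ys) (λ _ → refl) d)
count-cartesianProductWith f w u v w≡u+v (x ∷ xs) ys d = begin
  count w (map (f x) ys ++ cartesianProductWith f xs ys) d
    ≡⟨ count-++ w (map (f x) ys) _ d ⟩
  count w (map (f x) ys) d ℤ.+ count w (cartesianProductWith f xs ys) d
    ≡⟨ cong₂ ℤ._+_ row (count-cartesianProductWith f w u v w≡u+v xs ys d) ⟩
  (δ (u x) ⋆ count v ys) d ℤ.+ (count u xs ⋆ count v ys) d
    ≡⟨ ⋆-distribʳ-+ (δ (u x)) (count u xs) (count v ys) d ⟨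
  (count u (x ∷ xs) ⋆ count v ys) d
    ∎
  where
  open ≡-Reasoning
  row : count w (map (f x) ys) d ≡ (δ (u x) ⋆ count v ys) d
  row = begin
    count w (map (f x) ys) d          ≡⟨ count-map w (f x) ys d ⟩
    count (w ∘ f x) ys d              ≡⟨ count-cong (w≡u+v x) ys d ⟩
    count (λ y → u x ℕ.+ v y) ys d    ≡⟨ count-shift v (u x) ys d ⟩
    shift (u x) (count v ys) d        ≡⟨ δ-⋆ (u x) (count v ys) d ⟨
    (δ (u x) ⋆ count v ys) d          ∎

length-filter-≟ : ∀ (w : A → ℕ) d xs → + length (filter (λ x → w x ≟ d) xs) ≡ count w xs d
length-filter-≟ w d []       = refl
length-filter-≟ w d (x ∷ xs) with w x ≟ d
... | yes w≡d rewrite LP.filter-accept (λ x → w x ≟ d) {x} {xs} w≡d =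
  cong₂ ℤ._+_ (sym (trans (cong (λ k → δ k d) w≡d) (δ-refl d))) (length-filter-≟ w d xs)
... | no  w≢d rewrite LP.filter-reject (λ x → w x ≟ d) {x} {xs} w≢d = begin
  + length (filter (λ x → w x ≟ d) xs) ≡⟨ length-filter-≟ w d xs ⟩
  count w xs d                         ≡⟨ ℤP.+-identityˡ _ ⟨
  + 0 ℤ.+ count w xs d                 ≡⟨ cong (ℤ._+ count w xs d) (δ-≢ w≢d) ⟨
  δ (w x) d ℤ.+ count w xs d           ∎
  where open ≡-Reasoning

fromDegree2 : Series → Series
fromDegree2 f zero          = + 0
fromDegree2 f (suc zero)    = + 0
fromDegree2 f (suc (suc d)) = f (suc (suc d))

fromDegree2-cong : ∀ {f g} → f ≗ g → fromDegree2 f ≗ fromDegree2 g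
fromDegree2-cong f≗g zero          = refl
fromDegree2-cong f≗g (suc zero)    = refl
fromDegree2-cong f≗g (suc (suc d)) = f≗g (suc (suc d))

fromDegree2-+ : ∀ f g d → fromDegree2 (λ n → f n ℤ.+ g n) d ≡ fromDegree2 f d ℤ.+ fromDegree2 g d
fromDegree2-+ f g zero          = refl
fromDegree2-+ f g (suc zero)    = refl
fromDegree2-+ f g (suc (suc d)) = refl

fromDegree2-δ-≥2 : ∀ {k} → 2 ≤ k → fromDegree2 (δ k) ≗ δ k
fromDegree2-δ-≥2 (s≤s (s≤s _)) zero          = refl
fromDegree2-δ-≥2 (s≤s (s≤s _)) (suc zero)    = refl
fromDegree2-δ-≥2 (s≤s (s≤s _)) (suc (suc d)) = refl

fromDegree2-δ-<2 : ∀ {k} → ¬ 2 ≤ k → fromDegree2 (δ k) ≗ λ _ → + 0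
fromDegree2-δ-<2 {k} 2≰k zero          = refl
fromDegree2-δ-<2 {k} 2≰k (suc zero)    = refl
fromDegree2-δ-<2 {k} 2≰k (suc (suc d)) = δ-≢ {k} {suc (suc d)} (λ { refl → 2≰k (s≤s (s≤s z≤n)) })

count-filter-2≤ : ∀ (w : A → ℕ) xs → count w (filter (λ x → 2 ≤? w x) xs) ≗ fromDegree2 (count w xs)
count-filter-2≤ w []       zero          = refl
count-filter-2≤ w []       (suc zero)    = refl
count-filter-2≤ w []       (suc (suc d)) = refl
count-filter-2≤ w (x ∷ xs) d with 2 ≤? w x
... | yes 2≤w rewrite LP.filter-accept (λ x → 2 ≤? w x) {x} {xs} 2≤w = begin
  δ (w x) d ℤ.+ count w (filter (λ x → 2 ≤? w x) xs) d
    ≡⟨ cong₂ ℤ._+_ (sym (fromDegree2-δ-≥2 2≤w d)) (count-filter-2≤ w xs d) ⟩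
  fromDegree2 (δ (w x)) d ℤ.+ fromDegree2 (count w xs) d
    ≡⟨ fromDegree2-+ (δ (w x)) (count w xs) d ⟨
  fromDegree2 (count w (x ∷ xs)) d
    ∎
  where open ≡-Reasoning
... | no  2≰w rewrite LP.filter-reject (λ x → 2 ≤? w x) {x} {xs} 2≰w = begin
  count w (filter (λ x → 2 ≤? w x) xs) d
    ≡⟨ count-filter-2≤ w xs d ⟩
  fromDegree2 (count w xs) d
    ≡⟨ ℤP.+-identityˡ _ ⟨
  + 0 ℤ.+ fromDegree2 (count w xs) d
    ≡⟨ cong (ℤ._+ fromDegree2 (count w xs) d) (fromDegree2-δ-<2 2≰w d) ⟨
  fromDegree2 (δ (w x)) d ℤ.+ fromDegree2 (count w xs) d
    ≡⟨ fromDegree2-+ (δ (w x)) (count w xs) d ⟨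
  fromDegree2 (count w (x ∷ xs)) d
    ∎
  where open ≡-Reasoning

boundedVecs : ℕ → (r : ℕ) → List (Vec ℕ r)
boundedVecs c zero    = V.[] ∷ []
boundedVecs c (suc r) = cartesianProductWith V._∷_ (downFrom c) (boundedVecs c r)

coeffI-geomI : ∀ step c → coeffI (geomI step c) ≗ count (step ℕ.*_) (downFrom c)
coeffI-geomI step zero    d = refl
coeffI-geomI step (suc c) d = begin
  coeffI (addI (geomI step c) (monoI (step ℕ.* c))) d
    ≡⟨ coeffI-addI (geomI step c) (monoI (step ℕ.* c)) d ⟩
  coeffI (geomI step c) d ℤ.+ coeffI (monoI (step ℕ.* c)) d
    ≡⟨ cong₂ ℤ._+_ (coeffI-geomI step c d) (coeffI-monoI (step ℕ.* c) d) ⟩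
  count (step ℕ.*_) (downFrom c) d ℤ.+ δ (step ℕ.* c) d
    ≡⟨ ℤP.+-comm _ (δ (step ℕ.* c) d) ⟩
  count (step ℕ.*_) (downFrom (suc c)) d
    ∎
  where open ≡-Reasoning

coeffI-powI-geomI : ∀ step c r →
  coeffI (powI (geomI step c) r) ≗ count (λ v → step ℕ.* V.sum v) (boundedVecs c r)
coeffI-powI-geomI step c zero    zero    rewrite ℕP.*-zeroʳ step = refl
coeffI-powI-geomI step c zero    (suc d) rewrite ℕP.*-zeroʳ step = refl
coeffI-powI-geomI step c (suc r) d = begin
  coeffI (mulI (geomI step c) (powI (geomI step c) r)) d
    ≡⟨ coeffI-mulI (geomI step c) (powI (geomI step c) r) d ⟩
  (coeffI (geomI step c) ⋆ coeffI (powI (geomI step c) r)) d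
    ≡⟨ ⋆-cong (coeffI-geomI step c) (coeffI-powI-geomI step c r) d ⟩
  (count (step ℕ.*_) (downFrom c) ⋆ count (λ v → step ℕ.* V.sum v) (boundedVecs c r)) d
    ≡⟨ count-cartesianProductWith V._∷_ _ _ _ (λ x v → ℕP.*-distribˡ-+ step x (V.sum v))
                                  (downFrom c) (boundedVecs c r) d ⟨
  count (λ v → step ℕ.* V.sum v) (boundedVecs c (suc r)) d
    ∎
  where open ≡-Reasoning

count-downFrom-≥ : ∀ {c d} → c ≤ d → count (λ x → x) (downFrom c) d ≡ + 0
count-downFrom-≥ {zero}  _   = refl
count-downFrom-≥ {suc c} c<d =
  cong₂ ℤ._+_ (δ-≢ (ℕP.<⇒≢ c<d)) (count-downFrom-≥ (ℕP.<⇒≤ c<d))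

count-downFrom-< : ∀ {c d} → d < c → count (λ x → x) (downFrom c) d ≡ + 1
count-downFrom-< {suc c} {d} d<1+c with d ℕP.<? c
... | yes d<c = trans (cong₂ ℤ._+_ (δ-≢ (ℕP.>⇒≢ d<c)) (count-downFrom-< d<c)) (ℤP.+-identityˡ (+ 1))
... | no  d≮c with refl ← ℕP.≤-antisym (ℕP.≤-pred d<1+c) (ℕP.≮⇒≥ d≮c) =
  cong₂ ℤ._+_ (δ-refl c) (count-downFrom-≥ {c} ℕP.≤-refl)

coeffI-geomI-1-< : ∀ {c d} → d < c → coeffI (geomI 1 c) d ≡ + 1
coeffI-geomI-1-< {c} {d} d<c = begin
  coeffI (geomI 1 c) d              ≡⟨ coeffI-geomI 1 c d ⟩
  count (1 ℕ.*_) (downFrom c) d     ≡⟨ count-cong ℕP.*-identityˡ (downFrom c) d ⟩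
  count (λ x → x) (downFrom c) d    ≡⟨ count-downFrom-< d<c ⟩
  + 1                               ∎
  where open ≡-Reasoning

coeffI-powI-geomI-0-1 : ∀ {q} → 2 ≤ q → ∀ r →
  coeffI (powI (geomI 1 q) r) 0 ≡ + 1 × coeffI (powI (geomI 1 q) r) 1 ≡ + r
coeffI-powI-geomI-0-1 2≤q zero    = refl , refl
coeffI-powI-geomI-0-1 {q} 2≤q (suc r) =
  trans (coeffI-mulI G Gʳ 0) (cong₂ ℤ._*_ G₀ Gʳ₀) ,
  trans (coeffI-mulI G Gʳ 1)
    (trans (cong₂ ℤ._+_ (cong₂ ℤ._*_ G₀ Gʳ₁) (cong₂ ℤ._*_ G₁ Gʳ₀))
           (trans (cong (ℤ._+ + 1) (ℤP.*-identityˡ (+ r))) (cong +_ (ℕP.+-comm r 1))))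
  where
  G  = geomI 1 q
  Gʳ = powI G r
  G₀ = coeffI-geomI-1-< {q} {0} (ℕP.<-trans (s≤s z≤n) 2≤q)
  G₁ = coeffI-geomI-1-< {q} {1} 2≤q
  Gʳ₀ = proj₁ (coeffI-powI-geomI-0-1 2≤q r)
  Gʳ₁ = proj₂ (coeffI-powI-geomI-0-1 2≤q r)

coeffI-powI-geomI-minus-1+rt : ∀ {q} → 2 ≤ q → ∀ r →
  coeffI (addI (powI (geomI 1 q) r) (negI (addI (mulI (constI (+ r)) (monoI 1)) (constI (+ 1)))))
    ≗ fromDegree2 (coeffI (powI (geomI 1 q) r))
coeffI-powI-geomI-minus-1+rt {q} 2≤q r d = begin
  coeffI (addI Gʳ (negI L)) d          ≡⟨ coeffI-addI Gʳ (negI L) d ⟩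
  coeffI Gʳ d ℤ.+ coeffI (negI L) d   ≡⟨ cong (λ z → coeffI Gʳ d ℤ.+ z) (coeffI-negI L d) ⟩
  coeffI Gʳ d ℤ.- coeffI L d          ≡⟨ drop d ⟩
  fromDegree2 (coeffI Gʳ) d           ∎
  where
  open ≡-Reasoning
  Gʳ = powI (geomI 1 q) r
  L = addI (mulI (constI (+ r)) (monoI 1)) (constI (+ 1))
  drop : ∀ d → coeffI Gʳ d ℤ.- coeffI L d ≡ fromDegree2 (coeffI Gʳ) d
  drop zero          rewrite proj₁ (coeffI-powI-geomI-0-1 2≤q r) | ℤP.*-zeroʳ (+ r) = refl
  drop (suc zero)    rewrite proj₂ (coeffI-powI-geomI-0-1 2≤q r) | ℤP.*-identityʳ (+ r) = ℤP.+-inverseʳ (+ r)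
  drop (suc (suc d)) = ℤP.+-identityʳ _

∈-boundedVecs⁻ : ∀ c r {v : Vec ℕ r} → v ∈ boundedVecs c r → ∀ i → V.lookup v i < c
∈-boundedVecs⁻ c (suc r) v∈ i with ∈P.∈-cartesianProductWith⁻ V._∷_ (downFrom c) (boundedVecs c r) v∈
∈-boundedVecs⁻ c (suc r) v∈ Fin.zero    | x , _ , x∈ , _  , refl = ∈P.∈-downFrom⁻ x∈
∈-boundedVecs⁻ c (suc r) v∈ (Fin.suc i) | _ , w , _  , w∈ , refl = ∈-boundedVecs⁻ c r w∈ i

∈-boundedVecs⁺ : ∀ c r (v : Vec ℕ r) → (∀ i → V.lookup v i < c) → v ∈ boundedVecs c r
∈-boundedVecs⁺ c zero    V.[]      _     = here refl
∈-boundedVecs⁺ c (suc r) (x V.∷ v) v<c =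
  ∈P.∈-cartesianProductWith⁺ V._∷_ (∈P.∈-downFrom⁺ (v<c Fin.zero))
                             (∈-boundedVecs⁺ c r v (v<c ∘ Fin.suc))

boundedVecs-unique : ∀ c r → Unique (boundedVecs c r)
boundedVecs-unique c zero    = All.[] ∷ []
boundedVecs-unique c (suc r) =
  UniqueP.cartesianProductWith⁺ V._∷_ VP.∷-injective (UniqueP.downFrom⁺ c) (boundedVecs-unique c r)

lookup-injective : ∀ {xs : List A} → Unique xs → ∀ i j → L.lookup xs i ≡ L.lookup xs j → i ≡ j
lookup-injective (_ ∷ _)      Fin.zero    Fin.zero    _  = refl
lookup-injective (x∉xs ∷ _)   Fin.zero    (Fin.suc j) eq =
  contradiction refl (All.lookup x∉xs (subst (_∈ _) (sym eq) (∈P.∈-lookup j)))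
lookup-injective (x∉xs ∷ _)   (Fin.suc i) Fin.zero    eq =
  contradiction refl (All.lookup x∉xs (subst (_∈ _) eq (∈P.∈-lookup i)))
lookup-injective (_ ∷ unique) (Fin.suc i) (Fin.suc j) eq = cong Fin.suc (lookup-injective unique i j eq)

-- The index set of the basis

-- (a , b) stands for the monomial x^(a + q b) xₙ^(Q−1), whose degree is weight (a , b).
module IndexSet (q m′ r : ℕ) where

  Index : Set
  Index = Vec ℕ r × Vec ℕ r

  admissibleVecs : List (Vec ℕ r)
  admissibleVecs = filter (λ a → 2 ≤? V.sum a) (boundedVecs q r)

  multiplierVecs : List (Vec ℕ r)
  multiplierVecs = boundedVecs (q ^ m′) r

  weight₀ : Index → ℕ
  weight₀ (a , b) = V.sum a ℕ.+ q ℕ.* V.sum b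

  weight : Index → ℕ
  weight x = (q ^ suc m′ ∸ 1) ℕ.+ weight₀ x

  indexSet : ℕ → List Index
  indexSet d = filter (λ x → weight x ≟ d) (cartesianProduct admissibleVecs multiplierVecs)

  admissiblePoly multiplierPoly : IPoly
  admissiblePoly = addI (powI (geomI 1 q) r) (negI (addI (mulI (constI (+ r)) (monoI 1)) (constI (+ 1))))
  multiplierPoly = powI (geomI q (q ^ m′)) r

  count-admissibleVecs : 2 ≤ q → count V.sum admissibleVecs ≗ coeffI admissiblePoly
  count-admissibleVecs 2≤q n = begin
    count V.sum admissibleVecs n
      ≡⟨ count-filter-2≤ V.sum (boundedVecs q r) n ⟩
    fromDegree2 (count V.sum (boundedVecs q r)) n
      ≡⟨ fromDegree2-cong 1·sum n ⟩
    fromDegree2 (count (λ a → 1 ℕ.* V.sum a) (boundedVecs q r)) n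
      ≡⟨ fromDegree2-cong (coeffI-powI-geomI 1 q r) n ⟨
    fromDegree2 (coeffI (powI (geomI 1 q) r)) n
      ≡⟨ coeffI-powI-geomI-minus-1+rt 2≤q r n ⟨
    coeffI admissiblePoly n
      ∎
    where
    open ≡-Reasoning
    1·sum = count-cong (λ a → sym (ℕP.*-identityˡ (V.sum a))) (boundedVecs q r)

  count-pairs : 2 ≤ q →
    count weight₀ (cartesianProduct admissibleVecs multiplierVecs) ≗ coeffI (mulI admissiblePoly multiplierPoly)
  count-pairs 2≤q n = begin
    count weight₀ (cartesianProduct admissibleVecs multiplierVecs) n
      ≡⟨ count-cartesianProductWith _,_ weight₀ V.sum (λ b → q ℕ.* V.sum b) (λ _ _ → refl)
                                    admissibleVecs multiplierVecs n ⟩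
    (count V.sum admissibleVecs ⋆ count (λ b → q ℕ.* V.sum b) multiplierVecs) n
      ≡⟨ ⋆-cong (count-admissibleVecs 2≤q) (λ n → sym (coeffI-powI-geomI q (q ^ m′) r n)) n ⟩
    (coeffI admissiblePoly ⋆ coeffI multiplierPoly) n
      ≡⟨ coeffI-mulI admissiblePoly multiplierPoly n ⟨
    coeffI (mulI admissiblePoly multiplierPoly) n
      ∎
    where open ≡-Reasoning

  length-indexSet : 2 ≤ q → ∀ d → + length (indexSet d) ≡ coeffI (hilbRHS q (suc m′) (suc r)) d
  length-indexSet 2≤q d = begin
    + length (indexSet d)                      ≡⟨ length-filter-≟ weight d pairs ⟩
    count weight pairs d                       ≡⟨ count-shift weight₀ (Q ∸ 1) pairs d ⟩
    shift (Q ∸ 1) (count weight₀ pairs) d      ≡⟨ shift-cong (Q ∸ 1) (count-pairs 2≤q) d ⟩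
    shift (Q ∸ 1) (coeffI AB) d                ≡⟨ δ-⋆ (Q ∸ 1) (coeffI AB) d ⟨
    (δ (Q ∸ 1) ⋆ coeffI AB) d                  ≡⟨ ⋆-cong (coeffI-monoI (Q ∸ 1)) (λ _ → refl) d ⟨
    (coeffI (monoI (Q ∸ 1)) ⋆ coeffI AB) d     ≡⟨ coeffI-mulI (monoI (Q ∸ 1)) AB d ⟨
    coeffI (hilbRHS q (suc m′) (suc r)) d      ∎
    where
    open ≡-Reasoning
    Q = q ^ suc m′
    pairs = cartesianProduct admissibleVecs multiplierVecs
    AB = mulI admissiblePoly multiplierPoly

digits-injective : ∀ {q a a′ b b′} .{{_ : NonZero q}} → a < q → a′ < q →
                   a ℕ.+ q ℕ.* b ≡ a′ ℕ.+ q ℕ.* b′ → a ≡ a′ × b ≡ b′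
digits-injective {q} {a} {a′} {b} {b′} a<q a′<q eq = a≡a′ , b≡b′
  where
  open ≡-Reasoning
  a≡a′ : a ≡ a′
  a≡a′ = begin
    a                       ≡⟨ m<n⇒m%n≡m a<q ⟨
    a % q                   ≡⟨ [m+kn]%n≡m%n a b q ⟨
    (a ℕ.+ b ℕ.* q) % q     ≡⟨ cong (λ n → (a ℕ.+ n) % q) (ℕP.*-comm b q) ⟩
    (a ℕ.+ q ℕ.* b) % q     ≡⟨ cong (_% q) eq ⟩
    (a′ ℕ.+ q ℕ.* b′) % q   ≡⟨ cong (λ n → (a′ ℕ.+ n) % q) (ℕP.*-comm q b′) ⟩
    (a′ ℕ.+ b′ ℕ.* q) % q   ≡⟨ [m+kn]%n≡m%n a′ b′ q ⟩
    a′ % q                  ≡⟨ m<n⇒m%n≡m a′<q ⟩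
    a′                      ∎
  b≡b′ : b ≡ b′
  b≡b′ = ℕP.*-cancelˡ-≡ b b′ q
           (ℕP.+-cancelˡ-≡ a _ _ (trans eq (cong (ℕ._+ q ℕ.* b′) (sym a≡a′))))

digits-< : ∀ {q a b B} → a < q → b < B → a ℕ.+ q ℕ.* b < q ℕ.* B
digits-< {q} {a} {b} {B} a<q b<B = begin-strict
  a ℕ.+ q ℕ.* b    <⟨ ℕP.+-monoˡ-< (q ℕ.* b) a<q ⟩
  q ℕ.+ q ℕ.* b    ≡⟨ ℕP.*-suc q b ⟨
  q ℕ.* suc b      ≤⟨ ℕP.*-monoʳ-≤ q b<B ⟩
  q ℕ.* B          ∎
  where open ℕP.≤-Reasoning

digits-<⁻ : ∀ {q a b B} → a ℕ.+ q ℕ.* b < q ℕ.* B → b < B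
digits-<⁻ {q} {a} {b} {B} lt = ℕP.*-cancelˡ-< q b B (ℕP.≤-<-trans (ℕP.m≤n+m (q ℕ.* b) a) lt)

module _ {a ℓ} (M : CommutativeMonoid a ℓ) where
  open CommutativeMonoid M renaming (ε to 0#; trans to ≈-trans)
  open import Algebra.Properties.CommutativeMonoid.Sum M

  sum-zero : ∀ {n} (t : Vector Carrier n) → (∀ i → t i ≈ 0#) → sum t ≈ 0#
  sum-zero {n} t t≈0 = ≈-trans (sum-cong-≋ t≈0) (sum-replicate-zero n)

  sum-single : ∀ {n} (t : Vector Carrier n) i → (∀ j → j ≢ i → t j ≈ 0#) → sum t ≈ t i
  sum-single {suc n} t i t≈0 = begin
    sum t                      ≈⟨ sum-remove {i = i} t ⟩
    t i ∙ sum (t ∘ punchIn i)  ≈⟨ ∙-congˡ (sum-zero (t ∘ punchIn i) (λ j → t≈0 _ (FinP.punchInᵢ≢i i j))) ⟩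
    t i ∙ 0#                   ≈⟨ identityʳ (t i) ⟩
    t i                        ∎
    where open SetoidReasoning setoid

infixl 5 _∷ʳ_

_∷ʳ_ : ∀ {r} → Vector A r → A → Vector A (suc r)
_∷ʳ_ {r = zero}  f x Fin.zero    = x
_∷ʳ_ {r = suc r} f x Fin.zero    = f Fin.zero
_∷ʳ_ {r = suc r} f x (Fin.suc i) = (f ∘ Fin.suc ∷ʳ x) i

∷ʳ-inject₁ : ∀ {r} (f : Vector A r) x i → (f ∷ʳ x) (inject₁ i) ≡ f i
∷ʳ-inject₁ f x Fin.zero    = refl
∷ʳ-inject₁ f x (Fin.suc i) = ∷ʳ-inject₁ (f ∘ Fin.suc) x i

∷ʳ-last : ∀ {r} (f : Vector A r) x → (f ∷ʳ x) (fromℕ r) ≡ x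
∷ʳ-last {r = zero}  f x = refl
∷ʳ-last {r = suc r} f x = ∷ʳ-last (f ∘ Fin.suc) x

∷ʳ-cong : ∀ {r} {f g : Vector A r} {x y} → f ≗ g → x ≡ y → f ∷ʳ x ≗ g ∷ʳ y
∷ʳ-cong {r = zero}  f≗g refl Fin.zero    = refl
∷ʳ-cong {r = suc r} f≗g x≡y  Fin.zero    = f≗g Fin.zero
∷ʳ-cong {r = suc r} f≗g x≡y  (Fin.suc i) = ∷ʳ-cong (f≗g ∘ Fin.suc) x≡y i

∷ʳ-+ : ∀ {r} (f g : Vector ℕ r) x y →
       (λ k → (f ∷ʳ x) k ℕ.+ (g ∷ʳ y) k) ≗ (λ j → f j ℕ.+ g j) ∷ʳ (x ℕ.+ y)
∷ʳ-+ {zero}  f g x y Fin.zero    = refl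
∷ʳ-+ {suc r} f g x y Fin.zero    = refl
∷ʳ-+ {suc r} f g x y (Fin.suc i) = ∷ʳ-+ (f ∘ Fin.suc) (g ∘ Fin.suc) x y i

inject₁-or-last : ∀ {r} (k : Fin (suc r)) → (Σ (Fin r) λ i → k ≡ inject₁ i) ⊎ k ≡ fromℕ r
inject₁-or-last {zero}  Fin.zero    = inj₂ refl
inject₁-or-last {suc r} Fin.zero    = inj₁ (Fin.zero , refl)
inject₁-or-last {suc r} (Fin.suc k) with inject₁-or-last k
... | inj₁ (i , refl) = inj₁ (Fin.suc i , refl)
... | inj₂ refl       = inj₂ refl

sumℕ-map-allFin : ∀ n (f : Fin n → ℕ) → sumℕ (map f (L.allFin n)) ≡ ∑ f
sumℕ-map-allFin n f = trans (cong sumℕ (LP.map-tabulate (λ i → i) f)) (go n f)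
  where
  go : ∀ n (f : Fin n → ℕ) → sumℕ (L.tabulate f) ≡ ∑ f
  go zero    f = refl
  go (suc n) f = cong (f Fin.zero ℕ.+_) (go n (f ∘ Fin.suc))

V-sum-lookup : ∀ {r} (v : Vec ℕ r) → V.sum v ≡ ∑ (V.lookup v)
V-sum-lookup V.[]       = refl
V-sum-lookup (x V.∷ v) = cong (x ℕ.+_) (V-sum-lookup v)

∑-∷ʳ : ∀ {r} (f : Fin r → ℕ) x → ∑ (f ∷ʳ x) ≡ ∑ f ℕ.+ x
∑-∷ʳ {r} f x = trans (ℕΣ.sum-init-last (f ∷ʳ x))
                     (cong₂ ℕ._+_ (ℕΣ.sum-cong-≗ (∷ʳ-inject₁ f x)) (∷ʳ-last f x))

-- Coefficients of formal polynomials

module PolyProperties {c ℓ} (R : CommutativeRing c ℓ) (N : ℕ) where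
  open CommutativeRing R renaming (refl to ≈-refl; sym to ≈-sym; trans to ≈-trans)
  open Poly R N
  open SemiringSum semiring using (sum; sum-cong-≋)
  open SetoidReasoning setoid

  private
    allEqual : Exp → Exp → List (Fin N) → Bool
    allEqual e f = L.foldr (λ i b → (e i ℕ.≡ᵇ f i) ∧ b) true

    allEqual⇒All : ∀ e f l → T (allEqual e f l) → All (λ i → e i ≡ f i) l
    allEqual⇒All e f []      _ = []
    allEqual⇒All e f (i ∷ l) t with tᵢ , tₗ ← Equivalence.to BoolP.T-∧ t =
      ℕP.≡ᵇ⇒≡ (e i) (f i) tᵢ ∷ allEqual⇒All e f l tₗ

    All⇒allEqual : ∀ e f l → All (λ i → e i ≡ f i) l → T (allEqual e f l)
    All⇒allEqual e f []      []         = _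
    All⇒allEqual e f (i ∷ l) (eᵢ ∷ eₗ) =
      Equivalence.from BoolP.T-∧ (ℕP.≡⇒≡ᵇ (e i) (f i) eᵢ , All⇒allEqual e f l eₗ)

  =E⇒≗ : ∀ e f → T (e =E f) → e ≗ f
  =E⇒≗ e f t i = All.lookup (allEqual⇒All e f (L.allFin N) t) (∈P.∈-allFin i)

  ≗⇒=E : ∀ e f → e ≗ f → T (e =E f)
  ≗⇒=E e f e≗f = All⇒allEqual e f (L.allFin N) (All.universal e≗f _)

  _≗?_ : (e f : Exp) → Dec (e ≗ f)
  e ≗? f = FinP.all? (λ i → e i ≟ f i)

  coeff-∷-hit : ∀ a g p e → g ≗ e → coeff ((a , g) ∷ p) e ≡ a + coeff p e
  coeff-∷-hit a g p e g≗e with g =E e | ≗⇒=E g e g≗e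
  ... | true | _ = refl

  coeff-∷-miss : ∀ a g p e → ¬ g ≗ e → coeff ((a , g) ∷ p) e ≡ coeff p e
  coeff-∷-miss a g p e g≉e with g =E e in eq
  ... | true  = contradiction (=E⇒≗ g e (subst T (sym eq) _)) g≉e
  ... | false = refl

  coeff-cong : ∀ p {e e′} → e ≗ e′ → coeff p e ≡ coeff p e′
  coeff-cong []            e≗e′ = refl
  coeff-cong ((a , g) ∷ p) {e} {e′} e≗e′ with g ≗? e
  ... | yes g≗e = trans (coeff-∷-hit a g p e g≗e)
                        (trans (cong (λ z → a + z) (coeff-cong p e≗e′))
                               (sym (coeff-∷-hit a g p e′ (λ i → trans (g≗e i) (e≗e′ i)))))
  ... | no  g≉e = trans (coeff-∷-miss a g p e g≉e)
                        (trans (coeff-cong p e≗e′)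
                               (sym (coeff-∷-miss a g p e′ λ g≗e′ → g≉e λ i → trans (g≗e′ i) (sym (e≗e′ i)))))

  coeff-++ : ∀ p s e → coeff (p ++ s) e ≈ coeff p e + coeff s e
  coeff-++ []            s e = ≈-sym (+-identityˡ _)
  coeff-++ ((a , g) ∷ p) s e with g =E e
  ... | true  = ≈-trans (+-congˡ (coeff-++ p s e)) (≈-sym (+-assoc _ _ _))
  ... | false = coeff-++ p s e

  coeff-scale : ∀ k p e → coeff (scale k p) e ≈ k * coeff p e
  coeff-scale k []            e = ≈-sym (zeroʳ k)
  coeff-scale k ((a , g) ∷ p) e with g =E e
  ... | true  = ≈-trans (+-congˡ (coeff-scale k p e)) (≈-sym (distribˡ k a _))
  ... | false = coeff-scale k p e

  coeff-absent : ∀ p e → All (λ t → ¬ proj₂ t ≗ e) p → coeff p e ≈ 0#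
  coeff-absent []            e []           = ≈-refl
  coeff-absent ((a , g) ∷ p) e (g≉e ∷ p≉e) =
    ≈-trans (reflexive (coeff-∷-miss a g p e g≉e)) (coeff-absent p e p≉e)

  coeff-sumFin : ∀ k (f : Fin k → Pol) e → coeff (sumFin k f) e ≈ sum (λ i → coeff (f i) e)
  coeff-sumFin k f e = go k (λ i → i)
    where
    go : ∀ n (g : Fin n → Fin k) → coeff (L.concatMap f (L.tabulate g)) e ≈ sum (λ i → coeff (f (g i)) e)
    go zero    g = ≈-refl
    go (suc n) g = ≈-trans (coeff-++ (f (g Fin.zero)) _ e) (+-congˡ (go n (g ∘ Fin.suc)))

  unitE-hit : ∀ j k → unitE j k j ≡ k
  unitE-hit j k rewrite dec-true (j FinP.≟ j) refl = refl

  unitE-miss : ∀ {j i} k → j ≢ i → unitE j k i ≡ 0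
  unitE-miss {j} {i} k j≢i rewrite dec-false (j FinP.≟ i) j≢i = refl

  unitE-+ : ∀ j k l → unitE j (k ℕ.+ l) ≗ unitE j k +E unitE j l
  unitE-+ j k l i with j FinP.≟ i
  ... | yes _ = refl
  ... | no  _ = refl

  unitE-* : ∀ j n k i → n ℕ.* unitE j k i ≡ unitE j (n ℕ.* k) i
  unitE-* j n k i with j FinP.≟ i
  ... | yes _ = refl
  ... | no  _ = ℕP.*-zeroʳ n

  _·ₜ_ : Carrier × Exp → Carrier × Exp → Carrier × Exp
  (a , g) ·ₜ (b , h) = a * b , g +E h

  All-⊗ : ∀ {ℓ′} {P P′ P″ : Carrier × Exp → Set ℓ′} →
          (∀ {t u} → P t → P′ u → P″ (t ·ₜ u)) → ∀ {p s} → All P p → All P′ s → All P″ (p ⊗ s)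
  All-⊗ P·P′ []         s′ = []
  All-⊗ P·P′ (t′ ∷ p′) s′ = AllP.++⁺ (AllP.map⁺ (All.map (P·P′ t′) s′)) (All-⊗ P·P′ p′ s′)

  module EvalAt0 (v : Fin N) where

    -- evalAt0 p is p evaluated at x_v = 0 and all other variables 1.
    termAt0 : ℕ → Carrier → Carrier
    termAt0 zero    a = a
    termAt0 (suc _) a = 0#

    termAt0-≥1 : ∀ {k} → 1 ≤ k → ∀ a → termAt0 k a ≡ 0#
    termAt0-≥1 (s≤s _) a = refl

    evalAt0 : Pol → Carrier
    evalAt0 []            = 0#
    evalAt0 ((a , g) ∷ p) = termAt0 (g v) a + evalAt0 p

    termAt0-* : ∀ k l a b → termAt0 (k ℕ.+ l) (a * b) ≈ termAt0 k a * termAt0 l b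
    termAt0-* zero    zero    a b = ≈-refl
    termAt0-* zero    (suc l) a b = ≈-sym (zeroʳ a)
    termAt0-* (suc k) l       a b = ≈-sym (zeroˡ (termAt0 l b))

    evalAt0-++ : ∀ p s → evalAt0 (p ++ s) ≈ evalAt0 p + evalAt0 s
    evalAt0-++ []            s = ≈-sym (+-identityˡ _)
    evalAt0-++ ((a , g) ∷ p) s = ≈-trans (+-congˡ (evalAt0-++ p s)) (≈-sym (+-assoc _ _ _))

    evalAt0-scale : ∀ k p → evalAt0 (scale k p) ≈ k * evalAt0 p
    evalAt0-scale k []            = ≈-sym (zeroʳ k)
    evalAt0-scale k ((a , g) ∷ p) = begin
      termAt0 (g v) (k * a) + evalAt0 (scale k p)  ≈⟨ +-cong (termAt0-* 0 (g v) k a) (evalAt0-scale k p) ⟩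
      k * termAt0 (g v) a + k * evalAt0 p          ≈⟨ distribˡ k _ _ ⟨
      k * evalAt0 ((a , g) ∷ p)                    ∎

    evalAt0-⊗ : ∀ p s → evalAt0 (p ⊗ s) ≈ evalAt0 p * evalAt0 s
    evalAt0-⊗ []            s = ≈-sym (zeroˡ _)
    evalAt0-⊗ ((a , g) ∷ p) s = begin
      evalAt0 (map ((a , g) ·ₜ_) s ++ p ⊗ s)               ≈⟨ evalAt0-++ (map ((a , g) ·ₜ_) s) (p ⊗ s) ⟩
      evalAt0 (map ((a , g) ·ₜ_) s) + evalAt0 (p ⊗ s)       ≈⟨ +-cong (row s) (evalAt0-⊗ p s) ⟩
      termAt0 (g v) a * evalAt0 s + evalAt0 p * evalAt0 s   ≈⟨ distribʳ _ _ _ ⟨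
      evalAt0 ((a , g) ∷ p) * evalAt0 s                     ∎
      where
      row : ∀ s → evalAt0 (map ((a , g) ·ₜ_) s) ≈ termAt0 (g v) a * evalAt0 s
      row []            = ≈-sym (zeroʳ _)
      row ((b , h) ∷ s) = ≈-trans (+-cong (termAt0-* (g v) (h v) a b) (row s)) (≈-sym (distribˡ _ _ _))

  monomial : Exp → Pol
  monomial e = (1# , e) ∷ []

  coeff-monomial-hit : ∀ {g e} → g ≗ e → coeff (monomial g) e ≈ 1#
  coeff-monomial-hit {g} {e} g≗e = ≈-trans (reflexive (coeff-∷-hit 1# g [] e g≗e)) (+-identityʳ 1#)

  coeff-monomial-miss : ∀ {g e} → ¬ g ≗ e → coeff (monomial g) e ≈ 0#
  coeff-monomial-miss {g} {e} g≉e = reflexive (coeff-∷-miss 1# g [] e g≉e)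

  module _ (Q : ℕ) where
    open Quot Q

    coeff-lincomb : ∀ {k} (a : Fin k → Carrier) w e → coeff (lincomb a w) e ≈ sum (λ i → a i * coeff (w i) e)
    coeff-lincomb {k} a w e =
      ≈-trans (coeff-sumFin k (λ i → scale (a i) (w i)) e) (sum-cong-≋ (λ i → coeff-scale (a i) (w i) e))

    module _ {k} (E : Fin k → Exp) where

      coeff-lincomb-monomials-miss : ∀ a {e} → (∀ j → ¬ E j ≗ e) →
                                     coeff (lincomb a (monomial ∘ E)) e ≈ 0#
      coeff-lincomb-monomials-miss a {e} E≉e = begin
        coeff (lincomb a (monomial ∘ E)) e           ≈⟨ coeff-lincomb a (monomial ∘ E) e ⟩
        sum (λ i → a i * coeff (monomial (E i)) e)   ≈⟨ sum-zero +-commutativeMonoid _ vanish ⟩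
        0#                                           ∎
        where vanish = λ i → ≈-trans (*-congˡ (coeff-monomial-miss (E≉e i))) (zeroʳ (a i))

      coeff-lincomb-monomials-hit : (∀ i j → E i ≗ E j → i ≡ j) → ∀ a {j e} → E j ≗ e →
                                    coeff (lincomb a (monomial ∘ E)) e ≈ a j
      coeff-lincomb-monomials-hit E-injective a {j} {e} Eⱼ≗e = begin
        coeff (lincomb a (monomial ∘ E)) e           ≈⟨ coeff-lincomb a (monomial ∘ E) e ⟩
        sum (λ i → a i * coeff (monomial (E i)) e)   ≈⟨ sum-single +-commutativeMonoid _ j off-diagonal ⟩
        a j * coeff (monomial (E j)) e               ≈⟨ *-congˡ (coeff-monomial-hit Eⱼ≗e) ⟩
        a j * 1#                                     ≈⟨ *-identityʳ (a j) ⟩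
        a j                                          ∎
        where
        off-diagonal : ∀ i → i ≢ j → a i * coeff (monomial (E i)) e ≈ 0#
        off-diagonal i i≢j = ≈-trans (*-congˡ (coeff-monomial-miss Eᵢ≉e)) (zeroʳ (a i))
          where Eᵢ≉e = λ Eᵢ≗e → i≢j (E-injective i j (λ n → trans (Eᵢ≗e n) (sym (Eⱼ≗e n))))

      hasDim-monomials : ∀ {ℓ′} (W : Pol → Set ℓ′) →
        (∀ i j → E i ≗ E j → i ≡ j) →
        (∀ i → InBox (E i)) →
        (∀ i → W (monomial (E i))) →
        (∀ p → W p → ∀ e → InBox e → (∀ j → ¬ E j ≗ e) → coeff p e ≈ 0#) →
        HasDim W k
      hasDim-monomials W E-injective E-inBox W-monomial W-support =
        monomial ∘ E , W-monomial , independent , spanning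
        where
        independent : LinIndep (monomial ∘ E)
        independent a a·E≈0 i =
          ≈-trans (≈-sym (coeff-lincomb-monomials-hit E-injective a (λ _ → refl))) (a·E≈0 (E i) (E-inBox i))
        spanning : ∀ p → W p → Σ (Fin k → Carrier) λ a → p ≈A lincomb a (monomial ∘ E)
        spanning p p∈W = a , p≈a·E
          where
          a = λ j → coeff p (E j)
          p≈a·E : p ≈A lincomb a (monomial ∘ E)
          p≈a·E e e∈box with FinP.any? (λ j → E j ≗? e)
          ... | yes (j , Eⱼ≗e) =
            ≈-sym (≈-trans (coeff-lincomb-monomials-hit E-injective a Eⱼ≗e) (reflexive (coeff-cong p Eⱼ≗e)))
          ... | no  ∄j =
            ≈-trans (W-support p p∈W e e∈box (λ j Eⱼ≗e → ∄j (j , Eⱼ≗e)))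
                    (≈-sym (coeff-lincomb-monomials-miss a (λ j Eⱼ≗e → ∄j (j , Eⱼ≗e))))

-- Products of the f̃ᵢ with a generator

module FTildeProducts {c ℓ} (R : CommutativeRing c ℓ) (q r m : ℕ) (2≤q : 2 ≤ q) where
  open CommutativeRing R renaming (refl to ≈-refl; sym to ≈-sym; trans to ≈-trans)
  open Setup R q r m
  open PolyProperties R (suc r)
  open EvalAt0 xlast
  -- Multidegrees b : Fin r → ℕ in the f̃ᵢ are exponents of Poly R r.
  open Poly R r using () renaming (unitE to single)
  open PolyProperties R r using ()
    renaming (unitE-hit to single-hit; unitE-miss to single-miss; unitE-+ to single-+; unitE-* to single-*)
  module ≈-Reasoning = SetoidReasoning setoid

  unitE-inject₁ : ∀ i k → unitE (inject₁ i) k ≗ single i k ∷ʳ 0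
  unitE-inject₁ i k l with inject₁-or-last l
  ... | inj₂ refl = trans (unitE-miss k (FinP.fromℕ≢inject₁ {i = i} ∘ sym)) (sym (∷ʳ-last (single i k) 0))
  ... | inj₁ (j , refl) with i FinP.≟ j
  ...   | yes refl = trans (unitE-hit (inject₁ i) k) (sym (trans (∷ʳ-inject₁ (single i k) 0 i) (single-hit i k)))
  ...   | no  i≢j  = trans (unitE-miss k (i≢j ∘ FinP.inject₁-injective))
                           (sym (trans (∷ʳ-inject₁ (single i k) 0 j) (single-miss k i≢j)))

  unitE-last : ∀ k → unitE xlast k ≗ (λ _ → 0) ∷ʳ k
  unitE-last k l with inject₁-or-last l
  ... | inj₂ refl       = trans (unitE-hit xlast k) (sym (∷ʳ-last (λ (_ : Fin r) → 0) k))
  ... | inj₁ (j , refl) = trans (unitE-miss k FinP.fromℕ≢inject₁) (sym (∷ʳ-inject₁ _ k j))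

  singles : List (Fin r) → (Fin r → ℕ) → Fin r → ℕ
  singles l b j = L.foldr (λ i acc → single i (b i) j ℕ.+ acc) 0 l

  singles-allFin : ∀ b → singles (L.allFin r) b ≗ b
  singles-allFin b j = begin
    singles (L.allFin r) b j
      ≡⟨ LP.foldr-map ℕ._+_ (λ i → single i (b i) j) 0 (L.allFin r) ⟨
    sumℕ (map (λ i → single i (b i) j) (L.allFin r))
      ≡⟨ sumℕ-map-allFin r _ ⟩
    ∑ (λ i → single i (b i) j)
      ≡⟨ sum-single ℕP.+-0-commutativeMonoid _ j (λ i → single-miss (b i)) ⟩
    single j (b j) j
      ≡⟨ single-hit j (b j) ⟩
    b j
      ∎
    where open ≡-Reasoning

  ftildePower : (Fin r → ℕ) → Pol
  ftildePower b = L.foldr (λ i acc → powP (ftilde i) (b i) ⊗ acc) oneP (L.allFin r)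

  xₙ∤xᵢ^q : ∀ i → unitE (inject₁ i) q xlast ≡ 0
  xₙ∤xᵢ^q i = unitE-miss q (FinP.fromℕ≢inject₁ {i = i} ∘ sym)

  xₙ∣xᵢxₙ^q∸1 : ∀ i → 1 ≤ (unitE (inject₁ i) 1 +E unitE xlast (q ∸ 1)) xlast
  xₙ∣xᵢxₙ^q∸1 i
    rewrite unitE-miss {inject₁ i} 1 (FinP.fromℕ≢inject₁ {i = i} ∘ sym) | unitE-hit xlast (q ∸ 1)
    = ℕP.∸-monoˡ-≤ 1 2≤q

  data FTerm (b : Fin r → ℕ) : Carrier × Exp → Set c where
    divisible : ∀ {a g} → 1 ≤ g xlast → FTerm b (a , g)
    pure      : ∀ {a g} → g ≗ (λ j → q ℕ.* b j) ∷ʳ 0 → FTerm b (a , g)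

  FTerm-cong : ∀ {b b′} → b ≗ b′ → ∀ {t} → FTerm b t → FTerm b′ t
  FTerm-cong b≗b′ (divisible xₙ∣g) = divisible xₙ∣g
  FTerm-cong b≗b′ (pure g≗qb)      = pure λ k → trans (g≗qb k) (∷ʳ-cong (cong (q ℕ.*_) ∘ b≗b′) refl k)

  FTerm-·ₜ : ∀ {b b′ t u} → FTerm b t → FTerm b′ u → FTerm (λ j → b j ℕ.+ b′ j) (t ·ₜ u)
  FTerm-·ₜ (divisible xₙ∣g) _                = divisible (ℕP.≤-trans xₙ∣g (ℕP.m≤m+n _ _))
  FTerm-·ₜ (pure _)         (divisible xₙ∣h) = divisible (ℕP.≤-trans xₙ∣h (ℕP.m≤n+m _ _))
  FTerm-·ₜ {b} {b′} {_ , g} {_ , h} (pure g≗qb) (pure h≗qb′) = pure λ k → begin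
    g k ℕ.+ h k
      ≡⟨ cong₂ ℕ._+_ (g≗qb k) (h≗qb′ k) ⟩
    ((λ j → q ℕ.* b j) ∷ʳ 0) k ℕ.+ ((λ j → q ℕ.* b′ j) ∷ʳ 0) k
      ≡⟨ ∷ʳ-+ (λ j → q ℕ.* b j) (λ j → q ℕ.* b′ j) 0 0 k ⟩
    ((λ j → q ℕ.* b j ℕ.+ q ℕ.* b′ j) ∷ʳ 0) k
      ≡⟨ ∷ʳ-cong (λ j → ℕP.*-distribˡ-+ q (b j) (b′ j)) refl k ⟨
    ((λ j → q ℕ.* (b j ℕ.+ b′ j)) ∷ʳ 0) k
      ∎
    where open ≡-Reasoning

  FTerm-scale : ∀ {b} k p → All (FTerm b) p → All (FTerm b) (scale k p)
  FTerm-scale k []      []                    = []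
  FTerm-scale k (_ ∷ p) (divisible xₙ∣g ∷ ps) = divisible xₙ∣g ∷ FTerm-scale k p ps
  FTerm-scale k (_ ∷ p) (pure g≗qb ∷ ps)      = pure g≗qb ∷ FTerm-scale k p ps

  FTerm-oneP : All (FTerm (λ _ → 0)) oneP
  FTerm-oneP = pure (λ k → sym (trans (∷ʳ-cong (λ _ → ℕP.*-zeroʳ q) refl k) (zeros k))) ∷ []
    where
    zeros : ∀ {r} (k : Fin (suc r)) → ((λ (_ : Fin r) → 0) ∷ʳ 0) k ≡ 0
    zeros {zero}  Fin.zero    = refl
    zeros {suc r} Fin.zero    = refl
    zeros {suc r} (Fin.suc k) = zeros k

  FTerm-ftilde : ∀ i → All (FTerm (single i 1)) (ftilde i)
  FTerm-ftilde i = pure xᵢ^q≗ ∷ divisible (xₙ∣xᵢxₙ^q∸1 i) ∷ []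
    where
    xᵢ^q≗ : unitE (inject₁ i) q ≗ (λ j → q ℕ.* single i 1 j) ∷ʳ 0
    xᵢ^q≗ k = trans (unitE-inject₁ i q k) (∷ʳ-cong q·single refl k)
      where
      q·single : ∀ j → single i q j ≡ q ℕ.* single i 1 j
      q·single j = trans (cong (λ z → single i z j) (sym (ℕP.*-identityʳ q))) (sym (single-* i q 1 j))

  FTerm-powP : ∀ i k → All (FTerm (single i k)) (powP (ftilde i) k)
  FTerm-powP i zero    = All.map (FTerm-cong (λ j → single-* i 0 0 j)) FTerm-oneP
  FTerm-powP i (suc k) =
    All.map (FTerm-cong (λ j → sym (single-+ i 1 k j))) (All-⊗ FTerm-·ₜ (FTerm-ftilde i) (FTerm-powP i k))

  FTerm-ftildePower : ∀ b → All (FTerm b) (ftildePower b)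
  FTerm-ftildePower b = All.map (FTerm-cong (singles-allFin b)) (go (L.allFin r))
    where
    go : ∀ l → All (FTerm (singles l b)) (L.foldr (λ i acc → powP (ftilde i) (b i) ⊗ acc) oneP l)
    go []      = FTerm-oneP
    go (i ∷ l) = All-⊗ FTerm-·ₜ (FTerm-powP i (b i)) (go l)

  FTerm-evalF : ∀ P → All (λ t → Σ (Fin r → ℕ) λ b → FTerm b t) (evalF P)
  FTerm-evalF []            = []
  FTerm-evalF ((k , b) ∷ P) =
    AllP.++⁺ (All.map (b ,_) (FTerm-scale k (ftildePower b) (FTerm-ftildePower b))) (FTerm-evalF P)

  evalAt0-ftilde : ∀ i → evalAt0 (ftilde i) ≈ 1#
  evalAt0-ftilde i = begin
    termAt0 (unitE (inject₁ i) q xlast) 1# + (termAt0 xᵢxₙ^q∸1 (- 1#) + 0#)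
      ≈⟨ +-cong (reflexive (cong (λ k → termAt0 k 1#) (xₙ∤xᵢ^q i))) (+-identityʳ _) ⟩
    1# + termAt0 xᵢxₙ^q∸1 (- 1#)
      ≈⟨ +-congˡ (reflexive (termAt0-≥1 (xₙ∣xᵢxₙ^q∸1 i) (- 1#))) ⟩
    1# + 0#
      ≈⟨ +-identityʳ 1# ⟩
    1#
      ∎
    where
    open ≈-Reasoning
    xᵢxₙ^q∸1 = (unitE (inject₁ i) 1 +E unitE xlast (q ∸ 1)) xlast

  evalAt0-powP : ∀ i k → evalAt0 (powP (ftilde i) k) ≈ 1#
  evalAt0-powP i zero    = +-identityʳ 1#
  evalAt0-powP i (suc k) = ≈-trans (evalAt0-⊗ (ftilde i) (powP (ftilde i) k))
                                   (≈-trans (*-cong (evalAt0-ftilde i) (evalAt0-powP i k)) (*-identityˡ 1#))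

  evalAt0-ftildePower : ∀ b → evalAt0 (ftildePower b) ≈ 1#
  evalAt0-ftildePower b = go (L.allFin r)
    where
    go : ∀ l → evalAt0 (L.foldr (λ i acc → powP (ftilde i) (b i) ⊗ acc) oneP l) ≈ 1#
    go []      = +-identityʳ 1#
    go (i ∷ l) = ≈-trans (evalAt0-⊗ (powP (ftilde i) (b i)) _)
                         (≈-trans (*-cong (evalAt0-powP i (b i)) (go l)) (*-identityˡ 1#))

  genExp : (Fin r → ℕ) → Exp
  genExp a = L.foldr (λ i e → unitE (inject₁ i) (a i) +E e) (unitE xlast (Q ∸ 1)) (L.allFin r)

  genExp≗ : ∀ a → genExp a ≗ a ∷ʳ (Q ∸ 1)
  genExp≗ a k = trans (go (L.allFin r) k) (∷ʳ-cong (singles-allFin a) refl k)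
    where
    go : ∀ l → L.foldr (λ i e → unitE (inject₁ i) (a i) +E e) (unitE xlast (Q ∸ 1)) l
                 ≗ singles l a ∷ʳ (Q ∸ 1)
    go []      k = unitE-last (Q ∸ 1) k
    go (i ∷ l) k = trans (cong₂ ℕ._+_ (unitE-inject₁ i (a i) k) (go l k))
                         (∷ʳ-+ (single i (a i)) (singles l a) 0 (Q ∸ 1) k)

  basisExp : (Fin r → ℕ) → (Fin r → ℕ) → Exp
  basisExp a b = (λ j → a j ℕ.+ q ℕ.* b j) ∷ʳ (Q ∸ 1)

  basisExp-cong : ∀ {a a′ b b′} → a ≗ a′ → b ≗ b′ → basisExp a b ≗ basisExp a′ b′
  basisExp-cong a≗a′ b≗b′ = ∷ʳ-cong (λ j → cong₂ ℕ._+_ (a≗a′ j) (cong (q ℕ.*_) (b≗b′ j))) refl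

  degE-cong : ∀ {e e′} → e ≗ e′ → degE e ≡ degE e′
  degE-cong e≗e′ = cong sumℕ (LP.map-cong e≗e′ (L.allFin (suc r)))

  degE-basisExp : ∀ a b → degE (basisExp a b) ≡ (Q ∸ 1) ℕ.+ (∑ a ℕ.+ q ℕ.* ∑ b)
  degE-basisExp a b = begin
    degE (basisExp a b)
      ≡⟨ sumℕ-map-allFin (suc r) (basisExp a b) ⟩
    ∑ ((λ j → a j ℕ.+ q ℕ.* b j) ∷ʳ (Q ∸ 1))
      ≡⟨ ∑-∷ʳ (λ j → a j ℕ.+ q ℕ.* b j) (Q ∸ 1) ⟩
    ∑ (λ j → a j ℕ.+ q ℕ.* b j) ℕ.+ (Q ∸ 1)
      ≡⟨ cong (ℕ._+ (Q ∸ 1)) (ℕΣ.∑-distrib-+ a (λ j → q ℕ.* b j)) ⟩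
    ∑ a ℕ.+ ∑ (λ j → q ℕ.* b j) ℕ.+ (Q ∸ 1)
      ≡⟨ cong (λ n → ∑ a ℕ.+ n ℕ.+ (Q ∸ 1)) (ℕΣ.*-distribˡ-sum q b) ⟨
    ∑ a ℕ.+ q ℕ.* ∑ b ℕ.+ (Q ∸ 1)
      ≡⟨ ℕP.+-comm _ (Q ∸ 1) ⟩
    (Q ∸ 1) ℕ.+ (∑ a ℕ.+ q ℕ.* ∑ b)
      ∎
    where open ≡-Reasoning

  1≤Q : 1 ≤ Q
  1≤Q = ℕP.m^n>0 q {{ℕ.>-nonZero (ℕP.≤-trans (s≤s z≤n) 2≤q)}} m

  pure·gen : ∀ {g} a b → g ≗ (λ j → q ℕ.* b j) ∷ʳ 0 → g +E genExp a ≗ basisExp a b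
  pure·gen {g} a b g≗qb k = begin
    g k ℕ.+ genExp a k
      ≡⟨ cong₂ ℕ._+_ (g≗qb k) (genExp≗ a k) ⟩
    ((λ j → q ℕ.* b j) ∷ʳ 0) k ℕ.+ (a ∷ʳ (Q ∸ 1)) k
      ≡⟨ ∷ʳ-+ (λ j → q ℕ.* b j) a 0 (Q ∸ 1) k ⟩
    ((λ j → q ℕ.* b j ℕ.+ a j) ∷ʳ (Q ∸ 1)) k
      ≡⟨ ∷ʳ-cong (λ j → ℕP.+-comm (q ℕ.* b j) (a j)) refl k ⟩
    basisExp a b k
      ∎
    where open ≡-Reasoning

  divisible·gen : ∀ {g} a → 1 ≤ g xlast → Q ≤ (g +E genExp a) xlast
  divisible·gen {g} a xₙ∣g = begin
    Q                            ≡⟨ ℕP.m+[n∸m]≡n 1≤Q ⟨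
    1 ℕ.+ (Q ∸ 1)                ≤⟨ ℕP.+-monoˡ-≤ (Q ∸ 1) xₙ∣g ⟩
    g xlast ℕ.+ (Q ∸ 1)          ≡⟨ cong (g xlast ℕ.+_) (trans (genExp≗ a xlast) (∷ʳ-last a (Q ∸ 1))) ⟨
    g xlast ℕ.+ genExp a xlast   ∎
    where open ℕP.≤-Reasoning

  outsideBox : ∀ {g e} → InBox e → Q ≤ g xlast → ¬ g ≗ e
  outsideBox e∈box Q≤gₙ g≗e = ℕP.<⇒≱ (e∈box xlast) (subst (Q ≤_) (g≗e xlast) Q≤gₙ)

  coeff-⊗gen-hit : ∀ {a b e} p → All (FTerm b) p → InBox e → basisExp a b ≗ e →
                   coeff (p ⊗ gen a) e ≈ evalAt0 p
  coeff-⊗gen-hit []            []                   e∈box hit = ≈-refl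
  coeff-⊗gen-hit {a} {b} {e} ((c , g) ∷ p) (divisible xₙ∣g ∷ ps) e∈box hit = begin
    coeff ((c * 1# , g +E genExp a) ∷ p ⊗ gen a) e
      ≡⟨ coeff-∷-miss (c * 1#) (g +E genExp a) (p ⊗ gen a) e g·gen≉e ⟩
    coeff (p ⊗ gen a) e
      ≈⟨ coeff-⊗gen-hit p ps e∈box hit ⟩
    evalAt0 p
      ≈⟨ +-identityˡ _ ⟨
    0# + evalAt0 p
      ≡⟨ cong (_+ evalAt0 p) (termAt0-≥1 xₙ∣g c) ⟨
    termAt0 (g xlast) c + evalAt0 p
      ∎
    where
    open ≈-Reasoning
    g·gen≉e = outsideBox e∈box (divisible·gen {g} a xₙ∣g)
  coeff-⊗gen-hit {a} {b} {e} ((c , g) ∷ p) (pure g≗qb ∷ ps) e∈box hit = begin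
    coeff ((c * 1# , g +E genExp a) ∷ p ⊗ gen a) e
      ≡⟨ coeff-∷-hit (c * 1#) (g +E genExp a) (p ⊗ gen a) e (λ k → trans (pure·gen a b g≗qb k) (hit k)) ⟩
    c * 1# + coeff (p ⊗ gen a) e
      ≈⟨ +-cong (*-identityʳ c) (coeff-⊗gen-hit p ps e∈box hit) ⟩
    c + evalAt0 p
      ≡⟨ cong (λ k → termAt0 k c + evalAt0 p) (trans (g≗qb xlast) (∷ʳ-last (λ j → q ℕ.* b j) 0)) ⟨
    termAt0 (g xlast) c + evalAt0 p
      ∎
    where open ≈-Reasoning

  coeff-⊗gen-miss : ∀ {a b e} p → All (FTerm b) p → InBox e → ¬ basisExp a b ≗ e →
                    coeff (p ⊗ gen a) e ≈ 0#
  coeff-⊗gen-miss []            []                   e∈box miss = ≈-refl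
  coeff-⊗gen-miss {a} {b} {e} ((c , g) ∷ p) (divisible xₙ∣g ∷ ps) e∈box miss =
    ≈-trans (reflexive (coeff-∷-miss (c * 1#) (g +E genExp a) (p ⊗ gen a) e g·gen≉e))
            (coeff-⊗gen-miss p ps e∈box miss)
    where g·gen≉e = outsideBox e∈box (divisible·gen {g} a xₙ∣g)
  coeff-⊗gen-miss {a} {b} {e} ((c , g) ∷ p) (pure g≗qb ∷ ps) e∈box miss =
    ≈-trans (reflexive (coeff-∷-miss (c * 1#) (g +E genExp a) (p ⊗ gen a) e g·gen≉e))
            (coeff-⊗gen-miss p ps e∈box miss)
    where g·gen≉e = λ g·gen≗e → miss (λ k → trans (sym (pure·gen a b g≗qb k)) (g·gen≗e k))

  data Supported : Carrier × Exp → Set c where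
    beyondBox : ∀ {c g} → Q ≤ g xlast → Supported (c , g)
    onBasis   : ∀ {c g} a b → Admissible a → g ≗ basisExp a b → Supported (c , g)

  ⊗gen-supported : ∀ {a} → Admissible a → ∀ p → All (λ t → Σ (Fin r → ℕ) λ b → FTerm b t) p →
                   All Supported (p ⊗ gen a)
  ⊗gen-supported adm []            []                               = []
  ⊗gen-supported adm ((_ , g) ∷ p) ((b , divisible xₙ∣g) ∷ ps) =
    beyondBox (divisible·gen {g} _ xₙ∣g) ∷ ⊗gen-supported adm p ps
  ⊗gen-supported adm ((_ , g) ∷ p) ((b , pure g≗qb) ∷ ps)      =
    onBasis _ b adm (pure·gen _ b g≗qb) ∷ ⊗gen-supported adm p ps

  valueRep-supported : ∀ ρ → All Supported (valueRep ρ)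
  valueRep-supported []                  = []
  valueRep-supported ((a , adm , P) ∷ ρ) =
    AllP.++⁺ (⊗gen-supported adm (evalF P) (FTerm-evalF P)) (valueRep-supported ρ)

  basisRep : ∀ a → Admissible a → (Fin r → ℕ) → BGRep
  basisRep a adm b = (a , adm , (1# , b) ∷ []) ∷ []

  monomial≈basisRep : ∀ a adm b → monomial (basisExp a b) ≈A valueRep (basisRep a adm b)
  monomial≈basisRep a adm b e e∈box = ≈-sym (≈-trans value (compare (basisExp a b ≗? e)))
    where
    open ≈-Reasoning
    P = scale 1# (ftildePower b) ++ []
    FTerm-P : All (FTerm b) P
    FTerm-P = AllP.++⁺ (FTerm-scale 1# (ftildePower b) (FTerm-ftildePower b)) []
    evalAt0-P : evalAt0 P ≈ 1#
    evalAt0-P = begin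
      evalAt0 P                                ≈⟨ evalAt0-++ (scale 1# (ftildePower b)) [] ⟩
      evalAt0 (scale 1# (ftildePower b)) + 0#  ≈⟨ +-identityʳ _ ⟩
      evalAt0 (scale 1# (ftildePower b))       ≈⟨ evalAt0-scale 1# (ftildePower b) ⟩
      1# * evalAt0 (ftildePower b)             ≈⟨ *-identityˡ _ ⟩
      evalAt0 (ftildePower b)                  ≈⟨ evalAt0-ftildePower b ⟩
      1#                                       ∎
    value : coeff (valueRep (basisRep a adm b)) e ≈ coeff (P ⊗ gen a) e
    value = ≈-trans (coeff-++ (P ⊗ gen a) [] e) (+-identityʳ _)
    compare : Dec (basisExp a b ≗ e) → coeff (P ⊗ gen a) e ≈ coeff (monomial (basisExp a b)) e
    compare (yes hit)  =
      ≈-trans (coeff-⊗gen-hit P FTerm-P e∈box hit) (≈-trans evalAt0-P (≈-sym (coeff-monomial-hit hit)))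
    compare (no  miss) = ≈-trans (coeff-⊗gen-miss P FTerm-P e∈box miss) (≈-sym (coeff-monomial-miss miss))

-- A monomial basis of (B_G)_d

module Basis {c ℓ} (R : CommutativeRing c ℓ) (q m′ r : ℕ) (2≤q : 2 ≤ q) (d : ℕ) where
  open CommutativeRing R renaming (refl to ≈-refl; sym to ≈-sym; trans to ≈-trans)
  open Setup R q r (suc m′)
  open PolyProperties R (suc r)
  open FTildeProducts R q r (suc m′) 2≤q
  open IndexSet q m′ r

  instance
    q-nonZero : NonZero q
    q-nonZero = ℕ.>-nonZero (ℕP.≤-trans (s≤s z≤n) 2≤q)

  record Conditions (x : Index) : Set where
    field
      digits     : ∀ i → V.lookup (proj₁ x) i < q
      sum≥2      : 2 ≤ V.sum (proj₁ x)
      small      : ∀ i → V.lookup (proj₂ x) i < q ^ m′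
      weight≡d   : weight x ≡ d

  ∈-indexSet⁻ : ∀ {x} → x ∈ indexSet d → Conditions x
  ∈-indexSet⁻ x∈
    with x∈pairs , weight≡d ← ∈P.∈-filter⁻ (λ x → weight x ≟ d) x∈
    with a∈admissible , b∈ ← ∈P.∈-cartesianProduct⁻ admissibleVecs multiplierVecs x∈pairs
    with a∈ , sum≥2 ← ∈P.∈-filter⁻ (λ a → 2 ≤? V.sum a) a∈admissible
    = record
      { digits   = ∈-boundedVecs⁻ q r a∈
      ; sum≥2    = sum≥2
      ; small    = ∈-boundedVecs⁻ (q ^ m′) r b∈
      ; weight≡d = weight≡d
      }

  ∈-indexSet⁺ : ∀ {x} → Conditions x → x ∈ indexSet d
  ∈-indexSet⁺ {a , b} conds = ∈P.∈-filter⁺ (λ x → weight x ≟ d)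
    (∈P.∈-cartesianProduct⁺ (∈P.∈-filter⁺ (λ a → 2 ≤? V.sum a) (∈-boundedVecs⁺ q r a digits) sum≥2)
                            (∈-boundedVecs⁺ (q ^ m′) r b small))
    weight≡d
    where open Conditions conds

  exponentOf : Index → Exp
  exponentOf (a , b) = basisExp (V.lookup a) (V.lookup b)

  admissible : ∀ {x} → Conditions x → Admissible (V.lookup (proj₁ x))
  admissible {a , _} conds =
    digits , subst (2 ≤_) (trans (V-sum-lookup a) (sym (sumℕ-map-allFin r (V.lookup a)))) sum≥2
    where open Conditions conds

  degE-exponentOf : ∀ x → degE (exponentOf x) ≡ weight x
  degE-exponentOf (a , b) = trans (degE-basisExp (V.lookup a) (V.lookup b))
    (cong (λ n → (Q ∸ 1) ℕ.+ n) (sym (cong₂ (λ s t → s ℕ.+ q ℕ.* t) (V-sum-lookup a) (V-sum-lookup b))))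

  exponentOf-inBox : ∀ {x} → Conditions x → InBox (exponentOf x)
  exponentOf-inBox {a , b} conds k with inject₁-or-last k
  ... | inj₁ (i , refl) = subst (_< Q) (sym (∷ʳ-inject₁ _ (Q ∸ 1) i)) (digits-< (digits i) (small i))
    where open Conditions conds
  ... | inj₂ refl       = subst (_< Q) (sym (∷ʳ-last (λ j → V.lookup a j ℕ.+ q ℕ.* V.lookup b j) (Q ∸ 1)))
                                (ℕP.∸-monoʳ-< {Q} {1} {0} (s≤s z≤n) 1≤Q)

  exponentOf-injective : ∀ {x y} → Conditions x → Conditions y → exponentOf x ≗ exponentOf y → x ≡ y
  exponentOf-injective {a , b} {a′ , b′} conds conds′ eq =
    cong₂ _,_ (vec-ext (proj₁ ∘ digitwise)) (vec-ext (proj₂ ∘ digitwise))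
    where
    digitwise : ∀ i → V.lookup a i ≡ V.lookup a′ i × V.lookup b i ≡ V.lookup b′ i
    digitwise i = digits-injective (Conditions.digits conds i) (Conditions.digits conds′ i)
      (trans (sym (∷ʳ-inject₁ _ (Q ∸ 1) i)) (trans (eq (inject₁ i)) (∷ʳ-inject₁ _ (Q ∸ 1) i)))
    vec-ext : ∀ {v w : Vec ℕ r} → (∀ i → V.lookup v i ≡ V.lookup w i) → v ≡ w
    vec-ext {v} {w} v≗w = trans (sym (VP.tabulate∘lookup v)) (trans (VP.tabulate-cong v≗w) (VP.tabulate∘lookup w))

  k : ℕ
  k = length (indexSet d)

  conditions : ∀ j → Conditions (L.lookup (indexSet d) j)
  conditions j = ∈-indexSet⁻ (∈P.∈-lookup j)

  E : Fin k → Exp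
  E j = exponentOf (L.lookup (indexSet d) j)

  E-injective : ∀ i j → E i ≗ E j → i ≡ j
  E-injective i j Eᵢ≗Eⱼ = lookup-injective indexSet-unique i j
    (exponentOf-injective (conditions i) (conditions j) Eᵢ≗Eⱼ)
    where
    indexSet-unique = UniqueP.filter⁺ (λ x → weight x ≟ d)
      (UniqueP.cartesianProduct⁺ (UniqueP.filter⁺ (λ a → 2 ≤? V.sum a) (boundedVecs-unique q r))
                                 (boundedVecs-unique (q ^ m′) r))

  E-complete : ∀ {e a b} → InBox e → Admissible a → basisExp a b ≗ e → degE e ≡ d →
               Σ (Fin k) λ j → E j ≗ e
  E-complete {e} {a} {b} e∈box (a<q , 2≤∑a) hit deg≡d = j , subst (λ y → exponentOf y ≗ e) x≡xⱼ E≗e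
    where
    x : Index
    x = V.tabulate a , V.tabulate b
    E≗e : exponentOf x ≗ e
    E≗e n = trans (basisExp-cong (VP.lookup∘tabulate a) (VP.lookup∘tabulate b) n) (hit n)
    conds : Conditions x
    conds = record
      { digits   = λ i → subst (_< q) (sym (VP.lookup∘tabulate a i)) (a<q i)
      ; sum≥2    = subst (2 ≤_) (begin
          sumℕ (map a (L.allFin r))    ≡⟨ sumℕ-map-allFin r a ⟩
          ∑ a                          ≡⟨ ℕΣ.sum-cong-≗ (VP.lookup∘tabulate a) ⟨
          ∑ (V.lookup (V.tabulate a))  ≡⟨ V-sum-lookup (V.tabulate a) ⟨
          V.sum (V.tabulate a)         ∎) 2≤∑a
      ; small    = λ i → digits-<⁻ {q} {V.lookup (V.tabulate a) i}
          (subst (_< Q) (trans (sym (E≗e (inject₁ i))) (∷ʳ-inject₁ _ (Q ∸ 1) i)) (e∈box (inject₁ i)))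
      ; weight≡d = trans (sym (degE-exponentOf x)) (trans (degE-cong E≗e) deg≡d)
      }
      where open ≡-Reasoning
    x∈ = ∈-indexSet⁺ conds
    j = Any.index x∈
    x≡xⱼ : x ≡ L.lookup (indexSet d) j
    x≡xⱼ = AnyP.lookup-index x∈

  monomial-E∈BGd : ∀ j → BGd d (monomial (E j))
  monomial-E∈BGd j = (basisRep α adm β , monomial≈basisRep α adm β) , homogeneous
    where
    x = L.lookup (indexSet d) j
    α = V.lookup (proj₁ x)
    β = V.lookup (proj₂ x)
    adm = admissible (conditions j)
    homogeneous : HomogA d (monomial (E j))
    homogeneous e _ deg≢d = coeff-monomial-miss λ Eⱼ≗e →
      deg≢d (trans (sym (degE-cong Eⱼ≗e)) (trans (degE-exponentOf x) (Conditions.weight≡d (conditions j))))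

  BGd-support : ∀ p → BGd d p → ∀ e → InBox e → (∀ j → ¬ E j ≗ e) → coeff p e ≈ 0#
  BGd-support p ((ρ , p≈ρ) , homogeneous) e e∈box ∄j with degE e ≟ d
  ... | no  deg≢d = homogeneous e e∈box deg≢d
  ... | yes deg≡d = ≈-trans (p≈ρ e e∈box) (coeff-absent (valueRep ρ) e (All.map misses (valueRep-supported ρ)))
    where
    misses : ∀ {t} → Supported t → ¬ proj₂ t ≗ e
    misses (beyondBox Q≤gₙ)          = outsideBox e∈box Q≤gₙ
    misses (onBasis a b adm g≗basis) g≗e =
      uncurry ∄j (E-complete e∈box adm (λ n → trans (sym (g≗basis n)) (g≗e n)) deg≡d)

  hasDim : HasDim (BGd d) k
  hasDim = hasDim-monomials Q E (BGd d) E-injective (exponentOf-inBox ∘ conditions) monomial-E∈BGd BGd-support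

module _ {c ℓ} (F : CommutativeRing c ℓ) where
  open CommutativeRing F using (_≈_; 0#; 1#) renaming (sym to ≈-sym; trans to ≈-trans)

  cardinality≥2 : ¬ 1# ≈ 0# → ∀ {q} → HasCardinality F q → 2 ≤ q
  cardinality≥2 1≉0 {zero}        (_ , onto , _) with () ← proj₁ (onto 0#)
  cardinality≥2 1≉0 {suc zero}    (_ , onto , _) with Fin.zero , e₀≈1 ← onto 1# | Fin.zero , e₀≈0 ← onto 0# =
    contradiction (≈-trans (≈-sym e₀≈1) e₀≈0) 1≉0
  cardinality≥2 1≉0 {suc (suc q)} _ = s≤s (s≤s z≤n)

lemma9p6 : ∀ {c ℓ} (F : CommutativeRing c ℓ) → IsField F →
    (q : ℕ) → HasCardinality F q →
    (r : ℕ) → 1 ≤ r → (m : ℕ) → 1 ≤ m →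
    (d : ℕ) → Σ ℕ (λ k →
      Setup.HasDim F q r m (Setup.BGd F q r m d) k ×
      (+ k) ≡ coeffI (hilbRHS q m (suc r)) d)
lemma9p6 F isField q card r _ (suc m′) _ d = k , hasDim , length-indexSet 2≤q d
  where
  2≤q = cardinality≥2 F (proj₁ isField) card
  open Basis F q m′ r 2≤q d using (k; hasDim)
  open IndexSet q m′ r using (length-indexSet)
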